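{- There is no $2$-nearly Platonic graph of type $(3|3)$ whose two exceptional faces are non-touching.
   Context: All graphs are finite, simple, connected, planar and undirected, considered with a fixed plane embedding. The size (length) of a face is the length of the closed walk bounding it. For integers $k,d$, a $2$-nearly Platonic graph of type $(k|d)$ is a $k$-regular planar graph with $f>4$ faces such that $f-2$ of its faces have size $d$ and the remaining two faces (the exceptional faces) have sizes different from $d$. The two exceptional faces are touching if their boundaries share at least one vertex, and non-touching otherwise. -}

module Defs where

-- Plane graphs are represented combinatorially as (oriented) combinatorial
-- maps / rotation systems: darts (half-edges), a fixed-point-free involution
-- α pairing the two darts of each edge, and a permutation σ giving the
-- cyclic (clockwise) order of darts around each vertex.  Vertices are the
-- σ-orbits, faces are the φ-orbits with φ = σ ∘ α, and the size of a face
-- (length of its boundary walk) is the length of its φ-orbit.  The embedding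
-- is in the plane (sphere) iff Euler's formula  V - E + F = 2  holds.

open import Data.Nat using (ℕ; zero; suc; _+_; _*_; _<_; _≤_)
open import Data.Fin using (Fin)
open import Data.Product using (Σ; _×_; ∃-syntax)
open import Relation.Binary.PropositionalEquality using (_≡_; _≢_)
open import Relation.Nullary using (¬_)
open import Function using (_∘_)
open import Function.Definitions using (Injective; Surjective)

iter : {A : Set} → (A → A) → ℕ → A → A
iter g zero    x = x
iter g (suc k) x = g (iter g k x)

SameOrbit : {A : Set} → (A → A) → A → A → Set
SameOrbit g x y = ∃[ k ] (iter g k x ≡ y)

OrbitLength : {A : Set} → (A → A) → A → ℕ → Set
OrbitLength g x k =
  (0 < k) × (iter g k x ≡ x) × (∀ j → 0 < j → j < k → iter g j x ≢ x)

data Reach {A : Set} (α σ : A → A) (x : A) : A → Set where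
  here  : Reach α σ x x
  stepα : ∀ {y} → Reach α σ x y → Reach α σ x (α y)
  stepσ : ∀ {y} → Reach α σ x y → Reach α σ x (σ y)

-- A connected simple plane graph with n vertices, m edges and f faces,
-- given by a combinatorial map on the 2m darts Fin (2 * m).
-- vert d / face d : the vertex (tail of d) / face containing dart d.
record PlaneGraph (n m f : ℕ) : Set where
  field
    α      : Fin (2 * m) → Fin (2 * m)
    σ      : Fin (2 * m) → Fin (2 * m)
    α-inv  : ∀ d → α (α d) ≡ d
    α-fpf  : ∀ d → α d ≢ d
    σ-inj  : Injective _≡_ _≡_ σ
    vert   : Fin (2 * m) → Fin n
    face   : Fin (2 * m) → Fin f
    vert-surj : Surjective _≡_ _≡_ vert
    face-surj : Surjective _≡_ _≡_ face
    vert-orb  : ∀ d e → (vert d ≡ vert e → SameOrbit σ d e)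
                      × (SameOrbit σ d e → vert d ≡ vert e)
    face-orb  : ∀ d e → (face d ≡ face e → SameOrbit (σ ∘ α) d e)
                      × (SameOrbit (σ ∘ α) d e → face d ≡ face e)
    connected : ∀ d e → Reach α σ d e
    no-loop   : ∀ d → vert d ≢ vert (α d)
    no-multi  : ∀ d e → vert d ≡ vert e → vert (α d) ≡ vert (α e) → d ≡ e
    euler     : n + f ≡ m + 2

  φ : Fin (2 * m) → Fin (2 * m)
  φ = σ ∘ α

  Regular : ℕ → Set
  Regular k = ∀ d → OrbitLength σ d k

  FaceSize : Fin f → ℕ → Set
  FaceSize F s = ∀ d → face d ≡ F → OrbitLength φ d s

  TwoNearlyPlatonic : ℕ → ℕ → Fin f → Fin f → Set
  TwoNearlyPlatonic k s F₁ F₂ =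
    Regular k × (4 < f) × (F₁ ≢ F₂)
    × (∀ F → F ≢ F₁ → F ≢ F₂ → FaceSize F s)
    × (¬ FaceSize F₁ s) × (¬ FaceSize F₂ s)

  Touching : Fin f → Fin f → Set
  Touching F₁ F₂ = ∃[ d ] ∃[ e ] (face d ≡ F₁ × face e ≡ F₂ × vert d ≡ vert e)

module Submission where

-- Call a vertex F₂-free if none of its three darts lies on the
-- exceptional face F₂.  We show that F₂-freeness passes from a vertex u to
-- every neighbour v.  Suppose the third face at v (the one not containing
-- the edge uv) is F₂.  Since F₁ and F₂ do not touch, the two faces along uv
-- are not F₁, hence are triangles.  The third vertex w of one of them lies
-- on F₂ and on the third face X at u, so X ≠ F₁ and X is a triangle too.
-- But a cubic vertex surrounded by three triangles forces the neighbouring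
-- face F₂ to be a triangle, contradicting that F₂ is exceptional.  By
-- connectivity every vertex is then F₂-free (start from a vertex of F₁),
-- yet some dart lies on F₂.

open import Defs
open import Data.Nat using (ℕ; zero; suc; _<_; _*_; s≤s; z≤n)
open import Data.Fin using (Fin)
open import Data.Fin.Properties using (_≟_)
open import Relation.Nullary using (¬_; yes; no)
open import Data.Empty using (⊥)
open import Data.Product using (_×_; _,_; proj₁; proj₂)
open import Function using (_∘_)
open import Relation.Binary.PropositionalEquality
open ≡-Reasoning

iter-comm : {A : Set} (g : A → A) (p : ℕ) (w : A) → iter g p (g w) ≡ g (iter g p w)
iter-comm g zero    w = refl
iter-comm g (suc p) w = cong g (iter-comm g p w)

iter-periodic : {A : Set} (g : A → A) (p : ℕ) (z : A) → iter g p z ≡ z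
              → ∀ k → iter g p (iter g k z) ≡ iter g k z
iter-periodic g p z h zero    = h
iter-periodic g p z h (suc k) =
  trans (iter-comm g p (iter g k z)) (cong g (iter-periodic g p z h k))

module MapFacts {n m f : ℕ} (G : PlaneGraph n m f) where
  open PlaneGraph G

  vert-σ : ∀ d → vert (σ d) ≡ vert d
  vert-σ d = sym (proj₂ (vert-orb d (σ d)) (1 , refl))

  vert-σ² : ∀ d → vert (σ (σ d)) ≡ vert d
  vert-σ² d = trans (vert-σ (σ d)) (vert-σ d)

  face-φ : ∀ d → face (φ d) ≡ face d
  face-φ d = sym (proj₂ (face-orb d (φ d)) (1 , refl))

  face-σ≡face-α : ∀ e → face (σ e) ≡ face (α e)
  face-σ≡face-α e = trans (cong (face ∘ σ) (sym (α-inv e))) (face-φ (α e))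

  φ-α : ∀ w → φ (α w) ≡ σ w
  φ-α w = cong σ (α-inv w)

  -- No face has length 1: that would be a loop.
  φ-no-fixpoint : ∀ d → φ d ≢ d
  φ-no-fixpoint d eq = no-loop d (trans (cong vert (sym eq)) (vert-σ (α d)))

  -- No face has length 2 unless σ has a fixed point: the two edges of such
  -- a face would be parallel.
  φ²-no-fixpoint : (∀ d → σ d ≢ d) → ∀ d → φ (φ d) ≢ d
  φ²-no-fixpoint σ-fpf d eq = σ-fpf (α d) σαd≡αd
    where
    e = φ d
    d≡αe : d ≡ α e
    d≡αe = no-multi d (α e) (sym (trans (sym (vert-σ (α e))) (cong vert eq)))
             (trans (sym (vert-σ (α d))) (cong vert (sym (α-inv e))))
    σαd≡αd : σ (α d) ≡ α d
    σαd≡αd = trans (sym (α-inv e)) (cong α (sym d≡αe))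

module Cubic {n m f : ℕ} (G : PlaneGraph n m f) (reg : PlaneGraph.Regular G 3) where
  open PlaneGraph G
  open MapFacts G

  Tri : Fin (2 * m) → Set
  Tri d = φ (φ (φ d)) ≡ d

  σ³ : ∀ d → σ (σ (σ d)) ≡ d
  σ³ d = proj₁ (proj₂ (reg d))

  σ-fpf : ∀ d → σ d ≢ d
  σ-fpf d = proj₂ (proj₂ (reg d)) 1 (s≤s z≤n) (s≤s (s≤s z≤n))

  -- φ⁻¹ = α ∘ σ², since σ⁻¹ = σ².
  φ⁻¹-φ : ∀ d → α (σ (σ (φ d))) ≡ d
  φ⁻¹-φ d = trans (cong α (σ³ (α d))) (α-inv d)

  tri-φ² : ∀ t → Tri t → φ (φ t) ≡ α (σ (σ t))
  tri-φ² t h = trans (sym (φ⁻¹-φ (φ (φ t)))) (cong (α ∘ σ ∘ σ) h)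

  triangle-size : ∀ z → Tri z → FaceSize (face z) 3
  triangle-size z h d fd with proj₁ (face-orb z d) (sym fd)
  ... | k , refl = s≤s z≤n , iter-periodic φ 3 z h k , minimal
    where
    minimal : ∀ j → 0 < j → j < 3 → iter φ j (iter φ k z) ≢ iter φ k z
    minimal 1 _ _ = φ-no-fixpoint _
    minimal 2 _ _ = φ²-no-fixpoint σ-fpf _
    minimal (suc (suc (suc j))) _ (s≤s (s≤s (s≤s ())))

  -- Apex of a triangle: if the triangle through the edge y = (u,v) has
  -- third vertex w, then the dart q = α (φ y) at w, together with σ² q,
  -- lies on the faces across the other two triangle edges: the third face
  -- at u and the third face at v.
  apex-faces : ∀ y → Tri y → let q = α (φ y) in
                 face (σ (σ q)) ≡ face (σ (σ y)) × face q ≡ face (σ (σ (α y)))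
  apex-faces y ty = across-u , sym (face-σ≡face-α (σ (α y)))
    where
    q = α (φ y)
    across-u : face (σ (σ q)) ≡ face (σ (σ y))
    across-u = begin
      face (σ (σ q))                ≡⟨ cong (face ∘ σ) (tri-φ² y ty) ⟩
      face (φ (σ (σ y)))            ≡⟨ face-φ (σ (σ y)) ⟩
      face (σ (σ y))                ∎

  -- A vertex surrounded by three triangles forces the third face at each
  -- neighbour to be a triangle as well (locally the map is K₄).  Here the
  -- faces at u = vert y are those of y, α y (= face of σ y) and σ² y, and
  -- the conclusion concerns the third face at v = vert (α y).
  triangles-spread : ∀ y → Tri y → Tri (α y) → Tri (σ (σ y)) → Tri (σ (σ (α y)))
  triangles-spread y ty tx tt = begin
    φ (φ (φ z))                  ≡⟨ cong (φ ∘ φ) σαz≡ασ²q ⟩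
    φ (φ (α (σ (σ q))))          ≡⟨ cong φ (φ-α (σ (σ q))) ⟩
    φ (σ (σ (σ q)))              ≡⟨ cong φ (σ³ q) ⟩
    φ q                          ≡⟨ φ-α (σ x) ⟩
    z                            ∎
    where
    x = α y
    q = α (φ y)
    z = σ (σ x)
    -- around the triangle of σ² y, starting from the apex dart σ² q
    φσ²q≡ασy : φ (σ (σ q)) ≡ α (σ y)
    φσ²q≡ασy = begin
      φ (σ (σ q))                ≡⟨ cong (φ ∘ σ) (tri-φ² y ty) ⟩
      φ (φ (σ (σ y)))            ≡⟨ tri-φ² (σ (σ y)) tt ⟩
      α (σ (σ (σ (σ y))))        ≡⟨ cong α (σ³ (σ y)) ⟩
      α (σ y)                    ∎
    -- around the triangle of x
    αz≡φσy : α z ≡ φ (σ y)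
    αz≡φσy = begin
      α z                        ≡⟨ sym (tri-φ² x tx) ⟩
      φ (φ x)                    ≡⟨ cong φ (φ-α y) ⟩
      φ (σ y)                    ∎
    σαz≡ασ²q : σ (α z) ≡ α (σ (σ q))
    σαz≡ασ²q = begin
      σ (α z)                    ≡⟨ cong σ αz≡φσy ⟩
      σ (σ (α (σ y)))            ≡⟨ cong (σ ∘ σ) (sym φσ²q≡ασy) ⟩
      σ (σ (σ (α (σ (σ q)))))    ≡⟨ σ³ (α (σ (σ q))) ⟩
      α (σ (σ q))                ∎

module NonTouching {n m f : ℕ} (G : PlaneGraph n m f) (F₁ F₂ : Fin f)
  (reg : PlaneGraph.Regular G 3)
  (ordinary : ∀ F → F ≢ F₁ → F ≢ F₂ → PlaneGraph.FaceSize G F 3)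
  (F₂-not-triangle : ¬ PlaneGraph.FaceSize G F₂ 3)
  (apart : ¬ PlaneGraph.Touching G F₁ F₂) where
  open PlaneGraph G
  open MapFacts G
  open Cubic G reg

  no-common-vertex : ∀ d e → vert d ≡ vert e → face d ≡ F₁ → face e ≡ F₂ → ⊥
  no-common-vertex d e v fd fe = apart (d , e , fd , fe , v)

  tri-ordinary : ∀ d → face d ≢ F₁ → face d ≢ F₂ → Tri d
  tri-ordinary d n₁ n₂ = proj₁ (proj₂ (ordinary (face d) n₁ n₂ d refl))

  F₂-Free : Fin (2 * m) → Set
  F₂-Free d = (face d ≢ F₂) × (face (σ d) ≢ F₂) × (face (σ (σ d)) ≢ F₂)

  free-σ : ∀ d → F₂-Free d → F₂-Free (σ d)
  free-σ d (n₀ , n₁ , n₂) = n₁ , n₂ , (λ h → n₀ (trans (cong face (sym (σ³ d))) h))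

  -- If v = vert (α y) lies on F₂ through its third dart σ² (α y), then
  -- both faces along the edge uv touch F₂ at v, hence are not F₁; when u
  -- is F₂-free they are triangles.
  edge-triangles : ∀ y → F₂-Free y → face (σ (σ (α y))) ≡ F₂ → Tri y × Tri (α y)
  edge-triangles y (n₀ , n₁ , _) hF₂ =
    tri-ordinary y y-not-F₁ n₀ ,
    tri-ordinary x x-not-F₁ (λ h → n₁ (trans (face-σ≡face-α y) h))
    where
    x = α y
    y-not-F₁ : face y ≢ F₁
    y-not-F₁ h = no-common-vertex (σ x) (σ (σ x)) (sym (vert-σ (σ x)))
                   (trans (face-φ y) h) hF₂
    x-not-F₁ : face x ≢ F₁
    x-not-F₁ h = no-common-vertex x (σ (σ x)) (sym (vert-σ² x)) h hF₂

  -- Otherwise the third face at u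
  -- is either F₁, which then meets F₂ at the apex of the triangle of y, or
  -- a triangle, which makes F₂ a triangle.
  third-face-free : ∀ y → F₂-Free y → face (σ (σ (α y))) ≢ F₂
  third-face-free y free hF₂ with edge-triangles y free hF₂ | face (σ (σ y)) ≟ F₁
  ... | ty , _ | yes hF₁ =
    no-common-vertex (σ (σ q)) q (vert-σ² q)
      (trans (proj₁ (apex-faces y ty)) hF₁) (trans (proj₂ (apex-faces y ty)) hF₂)
    where
    q = α (φ y)
  ... | ty , tx | no σ²y-not-F₁ =
    F₂-not-triangle (subst (λ F → FaceSize F 3) hF₂
      (triangle-size (σ (σ (α y)))
        (triangles-spread y ty tx (tri-ordinary (σ (σ y)) σ²y-not-F₁ (proj₂ (proj₂ free))))))

  free-α : ∀ y → F₂-Free y → F₂-Free (α y)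
  free-α y free@(n₀ , n₁ , _) =
    (λ h → n₁ (trans (face-σ≡face-α y) h)) ,
    (λ h → n₀ (trans (sym (face-φ y)) h)) ,
    third-face-free y free

  free-everywhere : ∀ {d e} → F₂-Free d → Reach α σ d e → F₂-Free e
  free-everywhere free here      = free
  free-everywhere free (stepα r) = free-α _ (free-everywhere free r)
  free-everywhere free (stepσ r) = free-σ _ (free-everywhere free r)

  F₁-dart-free : ∀ d → face d ≡ F₁ → F₂-Free d
  F₁-dart-free d fd =
    no-common-vertex d d refl fd ,
    no-common-vertex d (σ d) (sym (vert-σ d)) fd ,
    no-common-vertex d (σ (σ d)) (sym (vert-σ² d)) fd

  contradiction : ⊥
  contradiction = proj₁ (free-everywhere (F₁-dart-free d₁ (proj₂ (face-surj F₁) refl))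
                                         (connected d₁ d₂))
                        (proj₂ (face-surj F₂) refl)
    where
    d₁ = proj₁ (face-surj F₁)
    d₂ = proj₁ (face-surj F₂)

mainTheorem1 : (n m f : ℕ) (G : PlaneGraph n m f) (F₁ F₂ : Fin f)
    → PlaneGraph.TwoNearlyPlatonic G 3 3 F₁ F₂
    → ¬ PlaneGraph.Touching G F₁ F₂
    → ⊥
mainTheorem1 n m f G F₁ F₂ (cubic , _ , _ , ordinary , _ , F₂-not-triangle) apart =
  NonTouching.contradiction G F₁ F₂ cubic ordinary F₂-not-triangle apart
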